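{- Let $n\ge 6$ be an integer with $n\equiv 2\pmod 4$, let $B=\{v\in V(C_n\square K_2): x_v+y_v\equiv 1\pmod 2\}$ and $A=V(C_n\square K_2)\setminus B$. If $v,w\in A$ satisfy $d_{C_n}(x_v,x_w)\equiv 3\pmod 4$, then $B_{v|w}\subseteq A$.
   Context: $C_n$ is the cycle with vertex set $[n]=\{1,\dots,n\}$, where $i$ is adjacent to $i+1$ for $1\le i<n$ and $n$ is adjacent to $1$; $K_2$ has vertex set $\{1,2\}$. The Cartesian product $C_n\square K_2$ has vertex set $[n]\times\{1,2\}$, with $(g,h)\sim(g',h')$ iff either $g=g'$ and $hh'$ is an edge of $K_2$, or $h=h'$ and $gg'\in E(C_n)$. A vertex $v$ is written $v=(x_v,y_v)$. $d$ denotes the shortest-path distance in $C_n\square K_2$. The bisector of $v,w$ is $B_{v|w}=\{x\in V(C_n\square K_2): d(v,x)=d(w,x)\}$. -}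

module Defs where

open import Data.Nat using (ℕ; zero; suc; _+_; _≤_; _%_)
open import Data.Fin using (Fin; toℕ)
open import Data.Product using (_×_; Σ; ∃; _,_)
open import Data.Sum using (_⊎_)
open import Relation.Binary.PropositionalEquality using (_≡_; _≢_)
open import Relation.Nullary using (¬_)

-- Vertex i : Fin n of C_n represents the label (toℕ i + 1) ∈ [n] = {1,…,n}.
-- Vertex j : Fin 2 of K_2 represents the label (toℕ j + 1) ∈ {1,2}.

CAdj : (n : ℕ) → Fin n → Fin n → Set
CAdj n i j = (suc (toℕ i) % suc (pred' n) ≡ toℕ j) ⊎ (suc (toℕ j) % suc (pred' n) ≡ toℕ i)
  where
  pred' : ℕ → ℕ
  pred' zero = zero
  pred' (suc m) = m

K2Adj : Fin 2 → Fin 2 → Set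
K2Adj h h' = h ≢ h'

V : ℕ → Set
V n = Fin n × Fin 2

PAdj : (n : ℕ) → V n → V n → Set
PAdj n (g , h) (g' , h') = (g ≡ g' × K2Adj h h') ⊎ (h ≡ h' × CAdj n g g')

data Walk {A : Set} (adj : A → A → Set) : A → A → ℕ → Set where
  here : ∀ {a} → Walk adj a a zero
  step : ∀ {a b c k} → adj a b → Walk adj b c k → Walk adj a c (suc k)

IsDist : {A : Set} → (A → A → Set) → A → A → ℕ → Set
IsDist adj a b k = Walk adj a b k × (∀ m → Walk adj a b m → k ≤ m)

xc : {n : ℕ} → V n → ℕ
xc (g , h) = suc (toℕ g)

yc : {n : ℕ} → V n → ℕ
yc (g , h) = suc (toℕ h)

InB : {n : ℕ} → V n → Set
InB v = (xc v + yc v) % 2 ≡ 1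

InA : {n : ℕ} → V n → Set
InA v = ¬ InB v

InBisector : (n : ℕ) → V n → V n → V n → Set
InBisector n v w x = ∃ λ k → IsDist (PAdj n) v x k × IsDist (PAdj n) w x k

module Submission where

-- Since n is even, C_n □ K_2 is bipartite and the parity of x_v + y_v is a proper 2-colouring, so
-- for v ∈ A the vertex x lies in A iff d(v, x) is even; it suffices to show that d(v, x) = d(w, x) = m
-- forces m to be even. Write cycle positions as integers mod n and distances as absolute values of
-- least displacements: d((i, a), (t, b)) = |s| + [a ≠ b] with t ≡ i + s. As d_C(x_v, x_w) is odd,
-- v and w lie on different layers, so the horizontal displacements s, s' from x_v, x_w to x_x
-- satisfy |s| = |s'| + 1 = m (or symmetrically). If s, s' have equal signs then s - s' = ±1 ≡ σ,
-- the displacement from x_v to x_w, so d_C(x_v, x_w) ≤ 1. Otherwise |s - s'| = 2m - 1 and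
-- d_C(x_v, x_w) is 2m - 1 or n - (2m - 1); since it is 3 mod 4 and n is 2 mod 4, m is even.

open import Defs
open import Data.Nat as ℕ using (ℕ; zero; suc; _≤_; _<_; _%_; _/_; z≤n; s≤s)
import Data.Nat.Properties as ℕP
open import Data.Nat.DivMod using (m≡m%n+[m/n]*n; m%n<n; m<n⇒m%n≡m; n%n≡0)
open import Data.Nat.Divisibility using (n∣m⇒m%n≡0)
open import Data.Integer using (ℤ; +_; -[1+_]; ∣_∣; _+_; _-_; -_; _*_; _⊖_; NonZero)
import Data.Integer.Properties as ℤP
open import Data.Integer.Divisibility.Signed
  using (_∣_; divides; ∣m∣n⇒∣m+n; ∣m⇒∣-m; ∣-trans; ∣⇒∣ᵤ; *-cancelˡ-∣)
open import Data.Integer.Tactic.RingSolver using (solve-∀)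
open import Data.Fin as Fin using (Fin; toℕ; fromℕ<; fromℕ; inject₁)
open import Data.Fin.Patterns using (0F; 1F)
import Data.Fin.Properties as FinP
open import Data.Product using (_×_; ∃; _,_; proj₁)
open import Data.Sum using (_⊎_; inj₁; inj₂)
open import Data.Empty using (⊥-elim)
open import Function using (_∘_)
open import Relation.Binary.PropositionalEquality
  using (_≡_; _≢_; refl; sym; trans; cong; subst; subst₂; module ≡-Reasoning)
open import Relation.Binary.Bundles using (Setoid)
import Relation.Binary.Reasoning.Setoid as SetoidReasoning
open import Relation.Nullary using (¬_)

-- Congruence modulo an integer

infix 4 _≡_[mod_]

-- A record rather than a synonym for m ∣ x - y, so that x and y can be inferred by unification.
record _≡_[mod_] (x y m : ℤ) : Set where
  constructor ∣-diff⇒mod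
  field mod⇒∣-diff : m ∣ x - y

open _≡_[mod_]

module _ {m : ℤ} where

  mod-reflexive : ∀ {x y} → x ≡ y → x ≡ y [mod m ]
  mod-reflexive {x} refl = ∣-diff⇒mod (divides (+ 0) (trans (ℤP.+-inverseʳ x) (sym (ℤP.*-zeroˡ m))))

  mod-refl : ∀ {x} → x ≡ x [mod m ]
  mod-refl = mod-reflexive refl

  mod-sym : ∀ {x y} → x ≡ y [mod m ] → y ≡ x [mod m ]
  mod-sym {x} {y} x≡y =
    ∣-diff⇒mod (subst (m ∣_) (neg-diff x y) (∣m⇒∣-m (mod⇒∣-diff x≡y)))
    where
    neg-diff : ∀ a b → - (a - b) ≡ b - a
    neg-diff = solve-∀

  mod-trans : ∀ {x y z} → x ≡ y [mod m ] → y ≡ z [mod m ] → x ≡ z [mod m ]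
  mod-trans {x} {y} {z} x≡y y≡z =
    ∣-diff⇒mod (subst (m ∣_) (telescope x y z) (∣m∣n⇒∣m+n (mod⇒∣-diff x≡y) (mod⇒∣-diff y≡z)))
    where
    telescope : ∀ a b c → (a - b) + (b - c) ≡ a - c
    telescope = solve-∀

  mod-+ : ∀ {x y u v} → x ≡ y [mod m ] → u ≡ v [mod m ] → x + u ≡ y + v [mod m ]
  mod-+ {x} {y} {u} {v} x≡y u≡v =
    ∣-diff⇒mod (subst (m ∣_) (interchange x y u v) (∣m∣n⇒∣m+n (mod⇒∣-diff x≡y) (mod⇒∣-diff u≡v)))
    where
    interchange : ∀ a b c d → (a - b) + (c - d) ≡ (a + c) - (b + d)
    interchange = solve-∀

  mod-neg : ∀ {x y} → x ≡ y [mod m ] → - x ≡ - y [mod m ]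
  mod-neg {x} {y} x≡y =
    ∣-diff⇒mod (subst (m ∣_) (neg-diff x y) (∣m⇒∣-m (mod⇒∣-diff x≡y)))
    where
    neg-diff : ∀ a b → - (a - b) ≡ - a - - b
    neg-diff = solve-∀

  mod-+ˡ : ∀ z {x y} → x ≡ y [mod m ] → z + x ≡ z + y [mod m ]
  mod-+ˡ z = mod-+ (mod-refl {x = z})

  mod-+ʳ : ∀ z {x y} → x ≡ y [mod m ] → x + z ≡ y + z [mod m ]
  mod-+ʳ z x≡y = mod-+ x≡y (mod-refl {x = z})

  mod-self : m ≡ + 0 [mod m ]
  mod-self = ∣-diff⇒mod (divides (+ 1) (trans (ℤP.+-identityʳ m) (sym (ℤP.*-identityˡ m))))

  mod-weaken : ∀ {d x y} → d ∣ m → x ≡ y [mod m ] → x ≡ y [mod d ]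
  mod-weaken d∣m x≡y = ∣-diff⇒mod (∣-trans d∣m (mod⇒∣-diff x≡y))

mod-setoid : ℤ → Setoid _ _
mod-setoid m = record
  { Carrier = ℤ
  ; _≈_ = λ x y → x ≡ y [mod m ]
  ; isEquivalence = record { refl = mod-refl ; sym = mod-sym ; trans = mod-trans }
  }

module _ {m : ℤ} where

  displacement-difference : ∀ {t a b s s' σ} → t ≡ a + s [mod m ] → t ≡ b + s' [mod m ] →
                            b ≡ a + σ [mod m ] → s - s' ≡ σ [mod m ]
  displacement-difference {t} {a} {b} {s} {s'} {σ} t≡a+s t≡b+s' b≡a+σ = begin
    s - s'                     ≡⟨ cancelˡ a s s' ⟨
    (a + s) - (a + s')         ≈⟨ mod-+ʳ (- (a + s')) (mod-sym t≡a+s) ⟩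
    t - (a + s')               ≈⟨ mod-+ʳ (- (a + s')) t≡b+s' ⟩
    (b + s') - (a + s')        ≈⟨ mod-+ʳ (- (a + s')) (mod-+ʳ s' b≡a+σ) ⟩
    (a + σ + s') - (a + s')    ≡⟨ cancel a σ s' ⟩
    σ                          ∎
    where
    open SetoidReasoning (mod-setoid m)
    cancelˡ : ∀ c u v → (c + u) - (c + v) ≡ u - v
    cancelˡ = solve-∀
    cancel : ∀ c u v → (c + u + v) - (c + v) ≡ u
    cancel = solve-∀

  displacement-reverse : ∀ {a b σ} → b ≡ a + σ [mod m ] → a ≡ b + - σ [mod m ]
  displacement-reverse {a} {b} {σ} b≡a+σ = begin
    a            ≡⟨ cancel a σ ⟨
    a + σ + - σ  ≈⟨ mod-+ʳ (- σ) (mod-sym b≡a+σ) ⟩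
    b + - σ      ∎
    where
    open SetoidReasoning (mod-setoid m)
    cancel : ∀ c u → c + u + - u ≡ c
    cancel = solve-∀

mod-cancel : ∀ k {m x y} .{{_ : NonZero k}} → k * x ≡ k * y [mod k * m ] → x ≡ y [mod m ]
mod-cancel k {m} {x} {y} kx≡ky =
  ∣-diff⇒mod (*-cancelˡ-∣ k (subst (k * m ∣_) (factor k x y) (mod⇒∣-diff kx≡ky)))
  where
  factor : ∀ c a b → c * a - c * b ≡ c * (a - b)
  factor = solve-∀

%⇒mod : ∀ {a r d} .{{_ : ℕ.NonZero d}} → a % d ≡ r → + a ≡ + r [mod + d ]
%⇒mod {a} {d = d} refl = ∣-diff⇒mod (divides (+ q) (begin
  + a - + r                 ≡⟨ cong (λ b → + b - + r) (m≡m%n+[m/n]*n a d) ⟩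
  + r + + (q ℕ.* d) - + r   ≡⟨ cong (λ b → + r + b - + r) (ℤP.pos-* q d) ⟩
  + r + + q * + d - + r     ≡⟨ cancel (+ r) (+ q * + d) ⟩
  + q * + d                 ∎))
  where
  open ≡-Reasoning
  r q : ℕ
  r = a % d
  q = a / d
  cancel : ∀ b c → b + c - b ≡ c
  cancel = solve-∀

mod-injective : ∀ {a b d} .{{_ : ℕ.NonZero d}} → a < d → b < d → + a ≡ + b [mod + d ] → a ≡ b
mod-injective {a} {b} {d} a<d b<d a≡b =
  ℤP.+-injective (ℤP.i-j≡0⇒i≡j (+ a) (+ b) (ℤP.∣i∣≡0⇒i≡0 ∣a-b∣≡0))
  where
  ∣a-b∣<d : ∣ + a - + b ∣ < d
  ∣a-b∣<d = ℕP.≤-<-trans (ℕP.≤-reflexive (cong ∣_∣ (ℤP.m-n≡m⊖n a b)))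
              (ℕP.≤-<-trans (ℤP.∣m⊝n∣≤m⊔n a b) (ℕP.⊔-lub a<d b<d))
  ∣a-b∣≡0 : ∣ + a - + b ∣ ≡ 0
  ∣a-b∣≡0 = trans (sym (m<n⇒m%n≡m ∣a-b∣<d)) (n∣m⇒m%n≡0 _ d (∣⇒∣ᵤ (mod⇒∣-diff a≡b)))

Even Odd : ℤ → Set
Even x = x ≡ + 0 [mod + 2 ]
Odd  x = x ≡ + 1 [mod + 2 ]

1≢0[mod2] : ¬ (+ 1 ≡ + 0 [mod + 2 ])
1≢0[mod2] 1≡0 with mod-injective (ℕP.n<1+n 1) ℕ.z<s 1≡0
... | ()

unit-odd : ∀ {e} → ∣ e ∣ ≡ 1 → Odd e
unit-odd {+ _}      refl = mod-refl
unit-odd { -[1+ _ ]} refl = ∣-diff⇒mod (divides (- + 1) refl)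

[mod4]⇒[mod2] : ∀ {x y} → x ≡ y [mod + 4 ] → x ≡ y [mod + 2 ]
[mod4]⇒[mod2] = mod-weaken (divides (+ 2) refl)

≡3[mod4]⇒Odd : ∀ {x} → x ≡ + 3 [mod + 4 ] → Odd x
≡3[mod4]⇒Odd x≡3 = mod-trans ([mod4]⇒[mod2] x≡3) (∣-diff⇒mod (divides (+ 1) refl))

≤1⇒≢3[mod4] : ∀ {a} → a ≤ 1 → ¬ (+ a ≡ + 3 [mod + 4 ])
≤1⇒≢3[mod4] a≤1 a≡3
  with subst (_≤ 1) (mod-injective (s≤s (ℕP.≤-trans a≤1 (s≤s z≤n))) ℕP.≤-refl a≡3) a≤1
... | s≤s ()

1+2b≡3[mod4]⇒Even[1+b] : ∀ b → + (suc b ℕ.+ b) ≡ + 3 [mod + 4 ] → Even (+ suc b)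
1+2b≡3[mod4]⇒Even[1+b] b 1+2b≡3 = mod-cancel (+ 2) (begin
  + 2 * + suc b          ≡⟨ double (+ b) ⟩
  + (suc b ℕ.+ b) + + 1  ≈⟨ mod-+ʳ (+ 1) 1+2b≡3 ⟩
  + 4                    ≈⟨ mod-self ⟩
  + 0                    ∎)
  where
  open SetoidReasoning (mod-setoid (+ 4))
  double : ∀ z → + 2 * (+ 1 + z) ≡ (+ 1 + z) + z + + 1
  double = solve-∀

complement≡3[mod4] : ∀ {a e n} → a ℕ.+ e ≡ n → + n ≡ + 2 [mod + 4 ] → + a ≡ + 3 [mod + 4 ] →
                     + e ≡ + 3 [mod + 4 ]
complement≡3[mod4] {a} {e} refl n≡2 a≡3 = begin
  + e              ≡⟨ cancel (+ a) (+ e) ⟨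
  + a + + e - + a  ≈⟨ mod-+ n≡2 (mod-neg a≡3) ⟩
  + 2 - + 3        ≈⟨ ∣-diff⇒mod (divides (- + 1) refl) ⟩
  + 3              ∎
  where
  open SetoidReasoning (mod-setoid (+ 4))
  cancel : ∀ c d → c + d - c ≡ d
  cancel = solve-∀

a≤∣a⊖n∣⇒a+a≤n : ∀ {a n} → 0 < n → a ≤ ∣ a ⊖ n ∣ → a ℕ.+ a ≤ n
a≤∣a⊖n∣⇒a+a≤n {a} {n} 0<n a≤∣a⊖n∣ with ℕP.≤-total a n
... | inj₁ a≤n = ℕP.m≤o∸n⇒m+n≤o a a≤n (subst (a ≤_) (ℤP.∣⊖∣-≤ a≤n) a≤∣a⊖n∣)
... | inj₂ n≤a = ⊥-elim (ℕP.<⇒≱ (ℕP.∸-monoʳ-< {a} {n} {0} 0<n n≤a)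
                                (subst (a ≤_) (cong ∣_∣ (ℤP.⊖-≥ n≤a)) a≤∣a⊖n∣))

consecutive-abs-diff : ∀ x y → ∣ x ∣ ≡ suc ∣ y ∣ →
                       ∣ x - y ∣ ≡ 1 ⊎ ∣ x - y ∣ ≡ suc ∣ y ∣ ℕ.+ ∣ y ∣
consecutive-abs-diff (+ _)      (+ b)      refl = inj₁ (cong ∣_∣ (cancel (+ b)))
  where
  cancel : ∀ z → + 1 + z - z ≡ + 1
  cancel = solve-∀
consecutive-abs-diff (+ _)      -[1+ b ]   refl = inj₂ refl
consecutive-abs-diff -[1+ a ]   (+ b)      refl =
  inj₂ (trans (cong ∣_∣ (neg-sum (+ suc a) (+ b))) (ℤP.∣-i∣≡∣i∣ (+ suc a + + b)))
  where
  neg-sum : ∀ u v → - u - v ≡ - (u + v)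
  neg-sum = solve-∀
consecutive-abs-diff -[1+ _ ]   -[1+ b ]   refl = inj₁ (cong ∣_∣ (cancel (+ suc b)))
  where
  cancel : ∀ z → - (+ 1 + z) - - z ≡ - + 1
  cancel = solve-∀

apart-by-one : ∀ {a b d d' m} → a ℕ.+ d ≡ m → b ℕ.+ d' ≡ m → d ≡ 0 → d' ≡ 1 → m ≡ a × a ≡ suc b
apart-by-one {a} {b} a+0≡m b+1≡m refl refl =
  trans (sym a+0≡m) (ℕP.+-identityʳ a) ,
  trans (sym (ℕP.+-identityʳ a)) (trans a+0≡m (trans (sym b+1≡m) (ℕP.+-comm b 1)))

-- Colours and layers of C_n □ K_2

walk-parity : ∀ {A : Set} {adj : A → A → Set} (c : A → ℤ) →
              (∀ {a b} → adj a b → c b ≡ c a + + 1 [mod + 2 ]) →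
              ∀ {a b m} → Walk adj a b m → c b ≡ c a + + m [mod + 2 ]
walk-parity c flip here = mod-reflexive (sym (ℤP.+-identityʳ _))
walk-parity c flip (step {a} {b} {d} {k} a~b w) = begin
  c d                ≈⟨ walk-parity c flip w ⟩
  c b + + k          ≈⟨ mod-+ʳ (+ k) (flip a~b) ⟩
  c a + + 1 + + k    ≡⟨ ℤP.+-assoc (c a) (+ 1) (+ k) ⟩
  c a + + suc k      ∎
  where open SetoidReasoning (mod-setoid (+ 2))

pos : ∀ {n} → Fin n → ℤ
pos i = + toℕ i

colour : ∀ {n} → V n → ℤ
colour (i , y) = pos i + pos y

colour≡label-sum : ∀ {n} (v : V n) → colour v ≡ + (xc v ℕ.+ yc v) [mod + 2 ]
colour≡label-sum (i , y) = begin
  pos i + pos y                    ≡⟨ ℤP.+-identityʳ (pos i + pos y) ⟨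
  pos i + pos y + + 0              ≈⟨ mod-+ˡ (pos i + pos y) (mod-sym mod-self) ⟩
  pos i + pos y + + 2              ≡⟨ regroup (pos i) (pos y) ⟩
  (+ 1 + pos i) + (+ 1 + pos y)    ∎
  where
  open SetoidReasoning (mod-setoid (+ 2))
  regroup : ∀ a b → a + b + + 2 ≡ (+ 1 + a) + (+ 1 + b)
  regroup = solve-∀

%2≢1⇒%2≡0 : ∀ a → ¬ a % 2 ≡ 1 → a % 2 ≡ 0
%2≢1⇒%2≡0 a a%2≢1 with a % 2 | m%n<n a 2
... | 0           | _                 = refl
... | 1           | _                 = ⊥-elim (a%2≢1 refl)
... | suc (suc _) | s≤s (s≤s ())

inB⇒odd : ∀ {n} (v : V n) → InB v → Odd (colour v)
inB⇒odd v v∈B = mod-trans (colour≡label-sum v) (%⇒mod v∈B)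

inA⇒even : ∀ {n} (v : V n) → InA v → Even (colour v)
inA⇒even v v∉B = mod-trans (colour≡label-sum v) (%⇒mod (%2≢1⇒%2≡0 (xc v ℕ.+ yc v) v∉B))

K2Adj⇒flip : ∀ {y y'} → K2Adj y y' → pos y' ≡ pos y + + 1 [mod + 2 ]
K2Adj⇒flip {0F} {0F} y≢y' = ⊥-elim (y≢y' refl)
K2Adj⇒flip {0F} {1F} _    = mod-refl
K2Adj⇒flip {1F} {0F} _    = mod-sym mod-self
K2Adj⇒flip {1F} {1F} y≢y' = ⊥-elim (y≢y' refl)

vdist : Fin 2 → Fin 2 → ℕ
vdist 0F 0F = 0
vdist 0F 1F = 1
vdist 1F 0F = 1
vdist 1F 1F = 0

vdist-self : ∀ y → vdist y y ≡ 0
vdist-self 0F = refl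
vdist-self 1F = refl

vdist≤1 : ∀ y y' → vdist y y' ≤ 1
vdist≤1 0F 0F = z≤n
vdist≤1 0F 1F = ℕP.≤-refl
vdist≤1 1F 0F = ℕP.≤-refl
vdist≤1 1F 1F = z≤n

vdist-split : ∀ {y y'} → y ≢ y' → ∀ z →
              (vdist y z ≡ 0 × vdist y' z ≡ 1) ⊎ (vdist y z ≡ 1 × vdist y' z ≡ 0)
vdist-split {0F} {0F} y≢y' _  = ⊥-elim (y≢y' refl)
vdist-split {0F} {1F} _    0F = inj₁ (refl , refl)
vdist-split {0F} {1F} _    1F = inj₂ (refl , refl)
vdist-split {1F} {0F} _    0F = inj₂ (refl , refl)
vdist-split {1F} {0F} _    1F = inj₁ (refl , refl)
vdist-split {1F} {1F} y≢y' _  = ⊥-elim (y≢y' refl)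

vertical-step-bound : ∀ {a m y₁ y'} y → a ℕ.+ vdist y₁ y' ≤ m → a ℕ.+ vdist y y' ≤ suc m
vertical-step-bound {a} {m} {y₁} {y'} y bound = begin
  a ℕ.+ vdist y y'        ≤⟨ ℕP.+-monoʳ-≤ a (vdist≤1 y y') ⟩
  a ℕ.+ 1                 ≡⟨ ℕP.+-comm a 1 ⟩
  suc a                   ≤⟨ s≤s (ℕP.m≤m+n a _) ⟩
  suc (a ℕ.+ vdist y₁ y') ≤⟨ s≤s bound ⟩
  suc m                   ∎
  where open ℕP.≤-Reasoning

horizontal-step-bound : ∀ e s {d m} → ∣ e ∣ ≡ 1 → ∣ s ∣ ℕ.+ d ≤ m → ∣ e + s ∣ ℕ.+ d ≤ suc m
horizontal-step-bound e s {d} {m} ∣e∣≡1 bound = begin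
  ∣ e + s ∣ ℕ.+ d           ≤⟨ ℕP.+-monoˡ-≤ d (ℤP.∣i+j∣≤∣i∣+∣j∣ e s) ⟩
  ∣ e ∣ ℕ.+ ∣ s ∣ ℕ.+ d     ≡⟨ cong (λ c → c ℕ.+ ∣ s ∣ ℕ.+ d) ∣e∣≡1 ⟩
  suc (∣ s ∣ ℕ.+ d)         ≤⟨ s≤s bound ⟩
  suc m                     ∎
  where open ℕP.≤-Reasoning

-- Distances in C_n □ K_2

-- n = suc p, so that the modulus suc (pred' n) in CAdj computes to n.
module Prism (p : ℕ) where

  n : ℕ
  n = suc p

  N : ℤ
  N = + n

  suc%n : ∀ {a b} → suc a % n ≡ b → + b ≡ + a + + 1 [mod N ]
  suc%n {a} {b} eq =
    mod-sym (subst (λ c → c ≡ + b [mod N ]) (ℤP.+-comm (+ 1) (+ a)) (%⇒mod eq))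

  suc%n⁻¹ : ∀ {a b} → suc a % n ≡ b → + a ≡ + b - + 1 [mod N ]
  suc%n⁻¹ {a} {b} eq = begin
    + a              ≡⟨ cancel (+ a) ⟨
    + a + + 1 - + 1  ≈⟨ mod-+ʳ (- + 1) (mod-sym (suc%n eq)) ⟩
    + b - + 1        ∎
    where
    open SetoidReasoning (mod-setoid N)
    cancel : ∀ c → c + + 1 - + 1 ≡ c
    cancel = solve-∀

  unit-step : ∀ {i j} → CAdj n i j → ∃ λ e → (∣ e ∣ ≡ 1) × pos j ≡ pos i + e [mod N ]
  unit-step (inj₁ i→j) = + 1 , refl , suc%n i→j
  unit-step (inj₂ j→i) = - + 1 , refl , suc%n⁻¹ j→i

  next : Fin n → Fin n
  next i = fromℕ< (m%n<n (suc (toℕ i)) n)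

  suc%n≡next : ∀ i → suc (toℕ i) % n ≡ toℕ (next i)
  suc%n≡next i = sym (FinP.toℕ-fromℕ< _)

  prev : Fin n → Fin n
  prev Fin.zero    = fromℕ p
  prev (Fin.suc i) = inject₁ i

  suc%n-prev : ∀ i → suc (toℕ (prev i)) % n ≡ toℕ i
  suc%n-prev Fin.zero    = trans (cong (λ a → suc a % n) (FinP.toℕ-fromℕ p)) (n%n≡0 n)
  suc%n-prev (Fin.suc i) = trans (cong (λ a → suc a % n) (FinP.toℕ-inject₁ i))
                                 (m<n⇒m%n≡m (s≤s (FinP.toℕ<n i)))

  iterate-walk : (f : Fin n → Fin n) (e : ℤ) → (∀ i → CAdj n i (f i)) →
                 (∀ i → pos (f i) ≡ pos i + e [mod N ]) →
                 ∀ i u → ∃ λ j → Walk (CAdj n) i j u × pos j ≡ pos i + + u * e [mod N ]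
  iterate-walk f e adj shift i zero    = i , here , mod-reflexive (no-steps (pos i) e)
    where
    no-steps : ∀ a e → a ≡ a + + 0 * e
    no-steps = solve-∀
  iterate-walk f e adj shift i (suc u) with iterate-walk f e adj shift (f i) u
  ... | j , w , j≡ = j , step (adj i) w , (begin
    pos j                ≈⟨ j≡ ⟩
    pos (f i) + + u * e  ≈⟨ mod-+ʳ (+ u * e) (shift i) ⟩
    pos i + e + + u * e  ≡⟨ regroup (pos i) e (+ u) ⟩
    pos i + (+ 1 + + u) * e ∎)
    where
    open SetoidReasoning (mod-setoid N)
    regroup : ∀ a e u → a + e + u * e ≡ a + (+ 1 + u) * e
    regroup = solve-∀

  pos-injective : ∀ {i j : Fin n} → pos i ≡ pos j [mod N ] → i ≡ j
  pos-injective i≡j =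
    FinP.toℕ-injective (mod-injective (FinP.toℕ<n _) (FinP.toℕ<n _) i≡j)

  forward-walk : ∀ i u → ∃ λ j → Walk (CAdj n) i j u × pos j ≡ pos i + + u [mod N ]
  forward-walk i u =
    let j , w , j≡ = iterate-walk next (+ 1) (inj₁ ∘ suc%n≡next) (suc%n ∘ suc%n≡next) i u
    in j , w , mod-trans j≡ (mod-reflexive (cong (λ z → pos i + z) (ℤP.*-identityʳ (+ u))))

  backward-walk : ∀ i u → ∃ λ j → Walk (CAdj n) i j u × pos j ≡ pos i - + u [mod N ]
  backward-walk i u =
    let j , w , j≡ = iterate-walk prev (- + 1) (inj₂ ∘ suc%n-prev) (suc%n⁻¹ ∘ suc%n-prev) i u
    in j , w , mod-trans j≡ (mod-reflexive (cong (λ z → pos i + z) u*-1≡-u))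
    where
    u*-1≡-u : + u * - + 1 ≡ - + u
    u*-1≡-u = trans (ℤP.*-comm (+ u) (- + 1)) (ℤP.-1*i≡-i (+ u))

  walk-to-congruent : ∀ {i j k u} → Walk (CAdj n) i k u → pos k ≡ pos j [mod N ] →
                      Walk (CAdj n) i j u
  walk-to-congruent {i} {u = u} w k≡j = subst (λ l → Walk (CAdj n) i l u) (pos-injective k≡j) w

  displacement⇒walk : ∀ {i j} s → pos j ≡ pos i + s [mod N ] → Walk (CAdj n) i j ∣ s ∣
  displacement⇒walk {i} (+ u) j≡ =
    let k , w , k≡ = forward-walk i u in walk-to-congruent w (mod-trans k≡ (mod-sym j≡))
  displacement⇒walk {i} -[1+ u ] j≡ =
    let k , w , k≡ = backward-walk i (suc u) in walk-to-congruent w (mod-trans k≡ (mod-sym j≡))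

  Minimal : ℤ → Set
  Minimal s = ∀ s' → s' ≡ s [mod N ] → ∣ s ∣ ≤ ∣ s' ∣

  minimal-neg : ∀ {s} → Minimal s → Minimal (- s)
  minimal-neg {s} min s' s'≡-s = subst₂ _≤_ (sym (ℤP.∣-i∣≡∣i∣ s)) (ℤP.∣-i∣≡∣i∣ s')
    (min (- s') (subst (λ t → - s' ≡ t [mod N ]) (ℤP.neg-involutive s) (mod-neg s'≡-s)))

  minimal-nonneg⇒a+a≤n : ∀ {a} → Minimal (+ a) → a ℕ.+ a ≤ n
  minimal-nonneg⇒a+a≤n {a} min =
    a≤∣a⊖n∣⇒a+a≤n ℕ.z<s (subst (a ≤_) (cong ∣_∣ (ℤP.m-n≡m⊖n a n)) (min (+ a - N) a-N≡a))
    where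
    open SetoidReasoning (mod-setoid N)
    a-N≡a : + a - N ≡ + a [mod N ]
    a-N≡a = begin
      + a - N    ≈⟨ mod-+ˡ (+ a) (mod-neg mod-self) ⟩
      + a + + 0  ≡⟨ ℤP.+-identityʳ (+ a) ⟩
      + a        ∎

  minimal⇒2∣s∣≤n : ∀ {s} → Minimal s → ∣ s ∣ ℕ.+ ∣ s ∣ ≤ n
  minimal⇒2∣s∣≤n {+ a}      min = minimal-nonneg⇒a+a≤n min
  minimal⇒2∣s∣≤n { -[1+ a ]} min = minimal-nonneg⇒a+a≤n (minimal-neg min)

  minimal⇒∣s∣<n : ∀ {s} → Minimal s → ∣ s ∣ < n
  minimal⇒∣s∣<n {s} min with ∣ s ∣ | minimal⇒2∣s∣≤n min
  ... | zero  | _     = ℕ.z<s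
  ... | suc a | 2a≤n = ℕP.<-≤-trans (ℕP.m<m+n (suc a) ℕ.z<s) 2a≤n

  opposite-signs : ∀ {a b} → a < n → b < n → + a ≡ - + b [mod N ] → a ≡ b ⊎ a ℕ.+ b ≡ n
  opposite-signs {b = zero}      a<n b<n a≡-b = inj₁ (mod-injective a<n b<n a≡-b)
  opposite-signs {a} {b@(suc _)} a<n b<n a≡-b =
    inj₂ (trans (cong (ℕ._+ b) a≡n∸b) (ℕP.m∸n+n≡m (ℕP.<⇒≤ b<n)))
    where
    open SetoidReasoning (mod-setoid N)
    -b≡n∸b : - + b ≡ + (n ℕ.∸ b) [mod N ]
    -b≡n∸b = begin
      - + b        ≡⟨ ℤP.+-identityˡ (- + b) ⟨
      + 0 - + b    ≈⟨ mod-+ʳ (- + b) (mod-sym mod-self) ⟩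
      N - + b      ≡⟨ ℤP.m-n≡m⊖n n b ⟩
      n ⊖ b        ≡⟨ ℤP.⊖-≥ (ℕP.<⇒≤ b<n) ⟩
      + (n ℕ.∸ b)  ∎
    a≡n∸b : a ≡ n ℕ.∸ b
    a≡n∸b = mod-injective a<n (ℕP.∸-monoʳ-< {n} {b} {0} ℕ.z<s (ℕP.<⇒≤ b<n))
                                (mod-trans a≡-b -b≡n∸b)

  residues-abs : ∀ {x y} → ∣ x ∣ < n → ∣ y ∣ < n → x ≡ y [mod N ] →
                 ∣ x ∣ ≡ ∣ y ∣ ⊎ ∣ x ∣ ℕ.+ ∣ y ∣ ≡ n
  residues-abs {+ a}      {+ b}      a<n b<n x≡y = inj₁ (mod-injective a<n b<n x≡y)
  residues-abs {+ a}      { -[1+ b ]} a<n b<n x≡y = opposite-signs a<n b<n x≡y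
  residues-abs { -[1+ a ]} {+ b}      a<n b<n x≡y = opposite-signs a<n b<n (mod-neg x≡y)
  residues-abs { -[1+ a ]} { -[1+ b ]} a<n b<n x≡y = inj₁ (mod-injective a<n b<n (mod-neg x≡y))

  lift : ∀ {i j m} y → Walk (CAdj n) i j m → Walk (PAdj n) (i , y) (j , y) m
  lift y here         = here
  lift y (step i~j w) = step (inj₂ (refl , i~j)) (lift y w)

  prism-walk⇒displacement : ∀ {i y t y' m} → Walk (PAdj n) (i , y) (t , y') m →
                            ∃ λ s → pos t ≡ pos i + s [mod N ] × ∣ s ∣ ℕ.+ vdist y y' ≤ m
  prism-walk⇒displacement {i} {y} here =
    + 0 , mod-reflexive (sym (ℤP.+-identityʳ (pos i))) , ℕP.≤-reflexive (vdist-self y)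
  prism-walk⇒displacement {y = y} (step (inj₁ (refl , _)) w) with prism-walk⇒displacement w
  ... | s , t≡ , bound = s , t≡ , vertical-step-bound y bound
  prism-walk⇒displacement {i} {t = t} (step {b = j , _} (inj₂ (refl , i~j)) w)
    with prism-walk⇒displacement w | unit-step i~j
  ... | s , t≡ , bound | e , ∣e∣≡1 , j≡ =
    e + s , t≡i+e+s , horizontal-step-bound e s ∣e∣≡1 bound
    where
    open SetoidReasoning (mod-setoid N)
    t≡i+e+s : pos t ≡ pos i + (e + s) [mod N ]
    t≡i+e+s = begin
      pos t            ≈⟨ t≡ ⟩
      pos j + s        ≈⟨ mod-+ʳ s j≡ ⟩
      pos i + e + s    ≡⟨ ℤP.+-assoc (pos i) e s ⟩
      pos i + (e + s)  ∎

  level-walk : ∀ {i t m} y → Walk (CAdj n) i t m → Walk (PAdj n) (i , y) (t , y) (m ℕ.+ 0)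
  level-walk y w = subst (Walk (PAdj n) _ _) (sym (ℕP.+-identityʳ _)) (lift y w)

  cross-walk : ∀ {i t m y y'} → y ≢ y' → Walk (CAdj n) i t m →
               Walk (PAdj n) (i , y) (t , y') (m ℕ.+ 1)
  cross-walk y≢y' w =
    subst (Walk (PAdj n) _ _) (ℕP.+-comm 1 _) (step (inj₁ (refl , y≢y')) (lift _ w))

  displacement⇒prism-walk : ∀ {i t} y y' s → pos t ≡ pos i + s [mod N ] →
                            Walk (PAdj n) (i , y) (t , y') (∣ s ∣ ℕ.+ vdist y y')
  displacement⇒prism-walk 0F 0F s t≡ = level-walk 0F (displacement⇒walk s t≡)
  displacement⇒prism-walk 0F 1F s t≡ = cross-walk (λ ()) (displacement⇒walk s t≡)
  displacement⇒prism-walk 1F 0F s t≡ = cross-walk (λ ()) (displacement⇒walk s t≡)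
  displacement⇒prism-walk 1F 1F s t≡ = level-walk 1F (displacement⇒walk s t≡)

  least-displacement : ∀ {a b s m} d → b ≡ a + s [mod N ] → ∣ s ∣ ℕ.+ d ≤ m →
                       (∀ s' → b ≡ a + s' [mod N ] → m ≤ ∣ s' ∣ ℕ.+ d) →
                       (∣ s ∣ ℕ.+ d ≡ m) × Minimal s
  least-displacement {a} d b≡ bound least =
    ℕP.≤-antisym bound (least _ b≡) ,
    λ s' s'≡s → ℕP.+-cancelʳ-≤ d _ _
                  (ℕP.≤-trans bound (least s' (mod-trans b≡ (mod-+ˡ a (mod-sym s'≡s)))))

  cycle-dist : ∀ {i j k} → IsDist (CAdj n) i j k →
               ∃ λ σ → pos j ≡ pos i + σ [mod N ] × (∣ σ ∣ ≡ k) × Minimal σ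
  cycle-dist {i} {k = k} (w , least) with prism-walk⇒displacement (lift 0F w)
  ... | σ , j≡ , bound
    with least-displacement {a = pos i} 0 j≡ bound
           (λ σ' j≡' → subst (k ≤_) (sym (ℕP.+-identityʳ _)) (least _ (displacement⇒walk σ' j≡')))
  ... | ∣σ∣+0≡k , min = σ , j≡ , trans (sym (ℕP.+-identityʳ _)) ∣σ∣+0≡k , min

  prism-dist : ∀ {i y t y' m} → IsDist (PAdj n) (i , y) (t , y') m →
               ∃ λ s → pos t ≡ pos i + s [mod N ] × (∣ s ∣ ℕ.+ vdist y y' ≡ m) × Minimal s
  prism-dist {i} {y} {y' = y'} (w , least) with prism-walk⇒displacement w
  ... | s , t≡ , bound = s , t≡ , least-displacement {a = pos i} (vdist y y') t≡ bound
                                    (λ s' t≡' → least _ (displacement⇒prism-walk y y' s' t≡'))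

  n≡2[mod4]⇒2∣N : + n ≡ + 2 [mod + 4 ] → + 2 ∣ N
  n≡2[mod4]⇒2∣N n≡2 =
    subst (+ 2 ∣_) (ℤP.+-identityʳ N) (mod⇒∣-diff (mod-trans ([mod4]⇒[mod2] n≡2) mod-self))

  CAdj⇒pos-flip : + 2 ∣ N → ∀ {i j} → CAdj n i j → pos j ≡ pos i + + 1 [mod + 2 ]
  CAdj⇒pos-flip 2∣N {i} i~j with unit-step i~j
  ... | e , ∣e∣≡1 , j≡ = mod-trans (mod-weaken 2∣N j≡) (mod-+ˡ (pos i) (unit-odd {e} ∣e∣≡1))

  PAdj⇒colour-flip : + 2 ∣ N → ∀ {u v} → PAdj n u v → colour v ≡ colour u + + 1 [mod + 2 ]
  PAdj⇒colour-flip _ {i , y} {_ , y'} (inj₁ (refl , y≢y')) = begin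
    pos i + pos y'           ≈⟨ mod-+ˡ (pos i) (K2Adj⇒flip y≢y') ⟩
    pos i + (pos y + + 1)    ≡⟨ ℤP.+-assoc (pos i) (pos y) (+ 1) ⟨
    pos i + pos y + + 1      ∎
    where open SetoidReasoning (mod-setoid (+ 2))
  PAdj⇒colour-flip 2∣N {i , y} {j , _} (inj₂ (refl , i~j)) = begin
    pos j + pos y            ≈⟨ mod-+ʳ (pos y) (CAdj⇒pos-flip 2∣N i~j) ⟩
    pos i + + 1 + pos y      ≡⟨ swap (pos i) (pos y) ⟩
    pos i + pos y + + 1      ∎
    where
    open SetoidReasoning (mod-setoid (+ 2))
    swap : ∀ a b → a + + 1 + b ≡ a + b + + 1
    swap = solve-∀

  layers-differ : + 2 ∣ N → ∀ {i j yv yw k} → Even (colour (i , yv)) → Even (colour (j , yw)) →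
                  Walk (CAdj n) i j k → Odd (+ k) → yv ≢ yw
  layers-differ 2∣N {i} {j} {y} {_} {k} v-even w-even w k-odd refl = 1≢0[mod2] (begin
    + 1                                    ≈⟨ mod-sym k-odd ⟩
    + k                                    ≡⟨ cancel (pos i) (+ k) (pos y) ⟨
    (pos i + + k + pos y) - colour (i , y) ≈⟨ mod-+ʳ (- colour (i , y)) i+k+y≡j+y ⟩
    colour (j , y) - colour (i , y)        ≈⟨ mod-+ w-even (mod-neg v-even) ⟩
    + 0                                    ∎)
    where
    open SetoidReasoning (mod-setoid (+ 2))
    i+k+y≡j+y : pos i + + k + pos y ≡ colour (j , y) [mod + 2 ]
    i+k+y≡j+y = mod-+ʳ (pos y) (mod-sym (walk-parity pos (CAdj⇒pos-flip 2∣N) w))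
    cancel : ∀ a c y → (a + c + y) - (a + y) ≡ c
    cancel = solve-∀

  -- s - s' is ±1 if s and s' have the same sign, which minimality of σ excludes,
  -- and ±(2|s'| + 1) otherwise.
  closer-by-one⇒even : + n ≡ + 2 [mod + 4 ] → ∀ {s s' σ} → Minimal s → Minimal σ →
                       s - s' ≡ σ [mod N ] → + ∣ σ ∣ ≡ + 3 [mod + 4 ] → ∣ s ∣ ≡ suc ∣ s' ∣ →
                       Even (+ ∣ s ∣)
  closer-by-one⇒even n≡2 {s} {s'} {σ} min-s min-σ D≡σ σ≡3 ∣s∣≡1+∣s'∣
    with consecutive-abs-diff s s' ∣s∣≡1+∣s'∣
  ... | inj₁ ∣D∣≡1 =
    ⊥-elim (≤1⇒≢3[mod4] (ℕP.≤-trans (min-σ (s - s') D≡σ) (ℕP.≤-reflexive ∣D∣≡1)) σ≡3)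
  ... | inj₂ ∣D∣≡E =
    subst (λ a → Even (+ a)) (sym ∣s∣≡1+∣s'∣) (1+2b≡3[mod4]⇒Even[1+b] ∣ s' ∣
      (E≡3 (residues-abs (minimal⇒∣s∣<n min-σ) ∣D∣<n (mod-sym D≡σ))))
    where
    E : ℕ
    E = suc ∣ s' ∣ ℕ.+ ∣ s' ∣
    ∣D∣<n : ∣ s - s' ∣ < n
    ∣D∣<n = ℕP.<-≤-trans (ℕP.≤-reflexive (cong suc (trans ∣D∣≡E (sym (ℕP.+-suc ∣ s' ∣ ∣ s' ∣)))))
              (subst (λ a → a ℕ.+ a ≤ n) ∣s∣≡1+∣s'∣ (minimal⇒2∣s∣≤n min-s))
    E≡3 : ∣ σ ∣ ≡ ∣ s - s' ∣ ⊎ ∣ σ ∣ ℕ.+ ∣ s - s' ∣ ≡ n → + E ≡ + 3 [mod + 4 ]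
    E≡3 (inj₁ ∣σ∣≡∣D∣) = subst (λ a → + a ≡ + 3 [mod + 4 ]) (trans ∣σ∣≡∣D∣ ∣D∣≡E) σ≡3
    E≡3 (inj₂ ∣σ∣+∣D∣≡n) =
      complement≡3[mod4] (subst (λ a → ∣ σ ∣ ℕ.+ a ≡ n) ∣D∣≡E ∣σ∣+∣D∣≡n) n≡2 σ≡3

  equidistant⇒even : + n ≡ + 2 [mod + 4 ] →
    ∀ {i j t yv yw yx k m} → yv ≢ yw → IsDist (CAdj n) i j k → + k ≡ + 3 [mod + 4 ] →
    IsDist (PAdj n) (i , yv) (t , yx) m → IsDist (PAdj n) (j , yw) (t , yx) m → Even (+ m)
  equidistant⇒even n≡2 {i} {j} {yx = yx} yv≢yw dk k≡3 dv dw
    with cycle-dist dk | prism-dist dv | prism-dist dw | vdist-split yv≢yw yx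
  ... | σ , j≡ , refl , min-σ | s , t≡v , s-dist , min-s | s' , t≡w , s'-dist , _
      | inj₁ (δv≡0 , δw≡1) =
    let m≡∣s∣ , ∣s∣≡1+∣s'∣ = apart-by-one {∣ s ∣} {∣ s' ∣} s-dist s'-dist δv≡0 δw≡1
    in subst (λ a → Even (+ a)) (sym m≡∣s∣)
         (closer-by-one⇒even n≡2 {s} {s'} {σ} min-s min-σ
            (displacement-difference {a = pos i} {pos j} {s} {s'} {σ} t≡v t≡w j≡) k≡3 ∣s∣≡1+∣s'∣)
  ... | σ , j≡ , refl , min-σ | s , t≡v , s-dist , _ | s' , t≡w , s'-dist , min-s'
      | inj₂ (δv≡1 , δw≡0) =
    let m≡∣s'∣ , ∣s'∣≡1+∣s∣ = apart-by-one {∣ s' ∣} {∣ s ∣} s'-dist s-dist δw≡0 δv≡1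
    in subst (λ a → Even (+ a)) (sym m≡∣s'∣)
         (closer-by-one⇒even n≡2 {s'} {s} { - σ} min-s' (minimal-neg min-σ)
            (displacement-difference {a = pos j} {pos i} {s'} {s} { - σ} t≡w t≡v
               (displacement-reverse {a = pos i} {pos j} {σ} j≡))
            (subst (λ a → + a ≡ + 3 [mod + 4 ]) (sym (ℤP.∣-i∣≡∣i∣ σ)) k≡3) ∣s'∣≡1+∣s∣)

mainTheorem13 : (n : ℕ) → 6 ≤ n → n % 4 ≡ 2 →
    (v w : V n) → InA v → InA w →
    (∃ λ k → IsDist (CAdj n) (proj₁ v) (proj₁ w) k × k % 4 ≡ 3) →
    (x : V n) → InBisector n v w x → InA x
mainTheorem13 zero ()
mainTheorem13 (suc p) _ n%4≡2 v w v∈A w∈A (k , dk , k%4≡3) x (m , dv , dw) x∈B =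
  1≢0[mod2] (begin
    + 1             ≈⟨ mod-sym (inB⇒odd x x∈B) ⟩
    colour x        ≈⟨ walk-parity colour (PAdj⇒colour-flip N-even) (proj₁ dv) ⟩
    colour v + + m  ≈⟨ mod-+ (inA⇒even v v∈A) m-even ⟩
    + 0             ∎)
  where
  open Prism p
  open SetoidReasoning (mod-setoid (+ 2))
  n≡2 : + n ≡ + 2 [mod + 4 ]
  n≡2 = %⇒mod n%4≡2
  N-even : + 2 ∣ N
  N-even = n≡2[mod4]⇒2∣N n≡2
  k≡3 : + k ≡ + 3 [mod + 4 ]
  k≡3 = %⇒mod k%4≡3
  m-even : Even (+ m)
  m-even = equidistant⇒even n≡2
             (layers-differ N-even (inA⇒even v v∈A) (inA⇒even w w∈A) (proj₁ dk)
                            (≡3[mod4]⇒Odd k≡3))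
             dk k≡3 dv dw
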